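{- Let $X',X''$ be a partition of an index set $X$, with sets $X_i$ ($i\in X$), $\Pi := \prod_{i\in X}X_i$, $\Pi' := \prod_{i\in X'}X_i$, $\Pi'' := \prod_{i\in X''}X_i$, and $\mu$ the choice function associated with a relation $\preceq$ as in the context. (1) If $\preceq$ is a smooth Hamming relation, then for every $\Sigma\subseteq\Pi$, writing $\Sigma' := \Sigma\upharpoonright X'$ and $\Sigma'' := \Sigma\upharpoonright X''$ (where $\Sigma$ need not equal $\Sigma'\times\Sigma''$): if $\mu(\Sigma')\times\mu(\Sigma'')\subseteq\Sigma$ then $\mu(\Sigma)=\mu(\Sigma')\times\mu(\Sigma'')$. (2) If $\preceq$ is a Hamming relation, then $(\mu*1)$ holds: for all $\Sigma'\subseteq\Pi'$, $\Sigma''\subseteq\Pi''$, $\mu(\Sigma'\times\Sigma'')=\mu(\Sigma')\times\mu(\Sigma'')$; consequently, if for $B\subseteq A$ we call $B\subseteq A$ big iff $\mu(A)\subseteq B$, then $(S*1)$ holds: for all $\Sigma'\subseteq\Pi'$, $\Sigma''\subseteq\Pi''$, $\Delta\subseteq\Sigma'\times\Sigma''$, $\Delta\subseteq\Sigma'\times\Sigma''$ is big iff there is $\Gamma'\times\Gamma''\subseteq\Delta$ with $\Gamma'\subseteq\Sigma'$ big and $\Gamma''\subseteq\Sigma''$ big.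
   Context: Write $\sigma'=\sigma\upharpoonright X'$, $\sigma''=\sigma\upharpoonright X''$ for $\sigma\in\Pi$, so $\sigma=\sigma'\circ\sigma''$ (concatenation); $\Sigma\upharpoonright X' = \{\sigma' : \sigma\in\Sigma\}$. A (generalized) Hamming relation is a reflexive relation $\preceq\subseteq(\Pi\times\Pi)\cup(\Pi'\times\Pi')\cup(\Pi''\times\Pi'')$ such that for all $\sigma,\tau\in\Pi$: $\sigma\preceq\tau$ iff $\sigma'\preceq\tau'$ and $\sigma''\preceq\tau''$. Let $x\prec y$ iff $x\preceq y$ and $x\neq y$. For $A$ a subset of $\Pi$, $\Pi'$ or $\Pi''$, $\mu(A) := \{x\in A : \neg\exists x'\in A\ (x'\prec x)\}$. $\preceq$ is smooth iff for every such $A$ and every $x\in A-\mu(A)$ there is $y\in\mu(A)$ with $y\prec x$. -}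

module Defs where

open import Data.Product using (Σ; ∃; _×_; _,_)
open import Data.Sum using (_⊎_; inj₁; inj₂)
open import Relation.Nullary using (¬_)
open import Relation.Binary.PropositionalEquality using (_≡_)

Pred : Set → Set₁
Pred T = T → Set

_⊆_ : {T : Set} → Pred T → Pred T → Set
A ⊆ B = ∀ x → A x → B x

_≐_ : {T : Set} → Pred T → Pred T → Set
A ≐ B = (A ⊆ B) × (B ⊆ A)

Prod : (I : Set) → (I → Set) → Set
Prod I X = (i : I) → X i

_≈_ : {I : Set} {X : I → Set} → Prod I X → Prod I X → Set
σ ≈ τ = ∀ i → σ i ≡ τ i

module _ {I : Set} {X : I → Set} (_⪯_ : Prod I X → Prod I X → Set) where

  _≺_ : Prod I X → Prod I X → Set
  x ≺ y = (x ⪯ y) × ¬ (x ≈ y)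

  μ : Pred (Prod I X) → Pred (Prod I X)
  μ A x = A x × ¬ (∃ λ y → A y × (y ≺ x))

  Smooth : Set₁
  Smooth = ∀ (A : Pred (Prod I X)) (x : Prod I X) → A x → ¬ μ A x →
           ∃ λ y → μ A y × (y ≺ x)

  Big : Pred (Prod I X) → Pred (Prod I X) → Set
  Big B A = (B ⊆ A) × (μ A ⊆ B)

  Reflexive : Set
  Reflexive = ∀ x → x ⪯ x

-- The partition X = X' ⊔ X'' of the index set is modelled as a disjoint
-- union I' ⊎ I''; Xs is the family of sets X_i.
module Split (I' I'' : Set) (Xs : I' ⊎ I'' → Set) where

  X' : I' → Set
  X' i = Xs (inj₁ i)

  X'' : I'' → Set
  X'' i = Xs (inj₂ i)

  Π : Set
  Π = Prod (I' ⊎ I'') Xs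

  Π' : Set
  Π' = Prod I' X'

  Π'' : Set
  Π'' = Prod I'' X''

  res' : Π → Π'
  res' σ i = σ (inj₁ i)

  res'' : Π → Π''
  res'' σ i = σ (inj₂ i)

  concat : Π' → Π'' → Π
  concat σ' σ'' (inj₁ i) = σ' i
  concat σ' σ'' (inj₂ i) = σ'' i

  restr' : Pred Π → Pred Π'
  restr' S y = ∃ λ σ → S σ × (res' σ ≈ y)

  restr'' : Pred Π → Pred Π''
  restr'' S y = ∃ λ σ → S σ × (res'' σ ≈ y)

  _⊠_ : Pred Π' → Pred Π'' → Pred Π
  (S' ⊠ S'') σ = S' (res' σ) × S'' (res'' σ)

  record Hamming : Set₁ where
    field
      _⪯_   : Π → Π → Set
      _⪯'_  : Π' → Π' → Set
      _⪯''_ : Π'' → Π'' → Set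
      refl   : Reflexive _⪯_
      refl'  : Reflexive _⪯'_
      refl'' : Reflexive _⪯''_
      ham⇒ : ∀ σ τ → σ ⪯ τ → (res' σ ⪯' res' τ) × (res'' σ ⪯'' res'' τ)
      ham⇐ : ∀ σ τ → (res' σ ⪯' res' τ) × (res'' σ ⪯'' res'' τ) → σ ⪯ τ

    μΠ : Pred Π → Pred Π
    μΠ = μ _⪯_
    μ' : Pred Π' → Pred Π'
    μ' = μ _⪯'_
    μ'' : Pred Π'' → Pred Π''
    μ'' = μ _⪯''_

    IsSmooth : Set₁
    IsSmooth = Smooth _⪯_ × Smooth _⪯'_ × Smooth _⪯''_

module Submission where

-- Write σ', σ'' for the two restrictions of σ ∈ Π and σ'∘σ''
-- for concatenation.  By the Hamming property, σ ≺ τ forces σ' ⪯' τ' and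
-- σ'' ⪯'' τ'' with σ', σ'' not both equal to τ', τ''; conversely a strict
-- step in one component together with a ⪯-step in the other is a strict
-- step in Π.  Hence
--   * a point whose components are minimal in A' and A'' cannot be strictly
--     undercut by any point of A' ⊠ A''                       (⊇ of (1), (μ*1));
--   * if σ ∈ μ(A' ⊠ A''), replacing one component by a strictly smaller one
--     would undercut σ                                          (⊆ of (μ*1)).
-- For (1) the factor sets are only the projections of Σ, so a strictly
-- smaller y' ∈ Σ' does not directly give an element of Σ; smoothness
-- replaces y' by a minimal z' ≺' σ' and σ'' by a minimal z'' ⪯'' σ'', and
-- the hypothesis μ(Σ') × μ(Σ'') ⊆ Σ puts z'∘z'' into Σ, undercutting σ.
-- (S*1) follows from (μ*1): the witnesses are Γ' = μ(Σ'), Γ'' = μ(Σ'').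

open import Defs renaming (_≺_ to Strict)
open import Data.Product using (∃; _×_; _,_; proj₁; proj₂)
open import Data.Sum using (_⊎_; inj₁; inj₂)
open import Function.Bundles using (_⇔_; mk⇔)
open import Relation.Nullary using (¬_)
open import Relation.Binary.PropositionalEquality using () renaming (refl to ≡-refl)

module ChoiceFunction {I : Set} {X : I → Set} (_⪯_ : Prod I X → Prod I X → Set) where

  _≺_ : Prod I X → Prod I X → Set
  _≺_ = Strict _⪯_

  μ-big : ∀ (A : Pred (Prod I X)) → Big _⪯_ (μ _⪯_ A) A
  μ-big A = (λ _ → proj₁) , (λ _ m → m)

  minimal-below : Smooth _⪯_ → ∀ {A : Pred (Prod I X)} {x y} →
    A x → A y → y ≺ x → ∃ λ z → μ _⪯_ A z × z ≺ x
  minimal-below smooth {A} {x} {y} ax ay y≺x =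
    smooth A x ax (λ { (_ , x-min) → x-min (y , ay , y≺x) })

  minimal-dominates : Smooth _⪯_ → Reflexive _⪯_ → ∀ {A : Pred (Prod I X)} {x} →
    A x → ¬ ¬ (∃ λ z → μ _⪯_ A z × z ⪯ x)
  minimal-dominates smooth reflexive {A} {x} ax no-dominator =
    let (z , z-min , z⪯x , _) = smooth A x ax (λ x-min → no-dominator (x , x-min , reflexive x))
    in no-dominator (z , z-min , z⪯x)

module HammingFacts (I' I'' : Set) (Xs : I' ⊎ I'' → Set) (H : Split.Hamming I' I'' Xs) where
  open Split I' I'' Xs
  open Hamming H

  _≺_ : Π → Π → Set
  _≺_ = Strict _⪯_
  _≺'_ : Π' → Π' → Set
  _≺'_ = Strict _⪯'_
  _≺''_ : Π'' → Π'' → Set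
  _≺''_ = Strict _⪯''_

  ≈-from-restrictions : ∀ {σ τ : Π} → res' σ ≈ res' τ → res'' σ ≈ res'' τ → σ ≈ τ
  ≈-from-restrictions e' e'' (inj₁ i) = e' i
  ≈-from-restrictions e' e'' (inj₂ i) = e'' i

  restr'-∈ : ∀ {S : Pred Π} {σ} → S σ → restr' S (res' σ)
  restr'-∈ {σ = σ} sσ = σ , sσ , λ _ → ≡-refl

  restr''-∈ : ∀ {S : Pred Π} {σ} → S σ → restr'' S (res'' σ)
  restr''-∈ {σ = σ} sσ = σ , sσ , λ _ → ≡-refl

  lift-≺' : ∀ (σ : Π) {z' z''} → z' ≺' res' σ → z'' ⪯'' res'' σ → concat z' z'' ≺ σ
  lift-≺' σ {z'} {z''} (z'⪯ , z'≉) z''⪯ =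
    ham⇐ (concat z' z'') σ (z'⪯ , z''⪯) , λ e → z'≉ (λ i → e (inj₁ i))

  lift-≺'' : ∀ (σ : Π) {z' z''} → z' ⪯' res' σ → z'' ≺'' res'' σ → concat z' z'' ≺ σ
  lift-≺'' σ {z'} {z''} z'⪯ (z''⪯ , z''≉) =
    ham⇐ (concat z' z'') σ (z'⪯ , z''⪯) , λ e → z''≉ (λ i → e (inj₂ i))

  -- If σ', σ'' are minimal in A', A'', then no τ with τ' ∈ A', τ'' ∈ A''
  -- is strictly below σ: one of its components would be strictly below.
  no-undercut : ∀ {A' : Pred Π'} {A'' : Pred Π''} {σ τ} →
    μ' A' (res' σ) → μ'' A'' (res'' σ) → A' (res' τ) → A'' (res'' τ) → ¬ (τ ≺ σ)
  no-undercut {σ = σ} {τ} (_ , σ'-min) (_ , σ''-min) τ'∈ τ''∈ (τ⪯σ , τ≉σ) =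
    let (τ'⪯ , τ''⪯) = ham⇒ τ σ τ⪯σ
    in σ'-min (res' τ , τ'∈ , τ'⪯ , λ e' →
         σ''-min (res'' τ , τ''∈ , τ''⪯ , λ e'' → τ≉σ (≈-from-restrictions e' e'')))

  μ-⊠-⊆ : ∀ (S' : Pred Π') (S'' : Pred Π'') → μΠ (S' ⊠ S'') ⊆ (μ' S' ⊠ μ'' S'')
  μ-⊠-⊆ S' S'' σ ((s' , s'') , σ-min) =
    (s' , λ { (y' , y'∈ , y'≺) →
       σ-min (concat y' (res'' σ) , (y'∈ , s'') , lift-≺' σ y'≺ (refl'' _)) }) ,
    (s'' , λ { (y'' , y''∈ , y''≺) →
       σ-min (concat (res' σ) y'' , (s' , y''∈) , lift-≺'' σ (refl' _) y''≺) })

  μ-⊠-⊇ : ∀ (S' : Pred Π') (S'' : Pred Π'') → (μ' S' ⊠ μ'' S'') ⊆ μΠ (S' ⊠ S'')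
  μ-⊠-⊇ S' S'' σ (σ'-min , σ''-min) =
    (proj₁ σ'-min , proj₁ σ''-min) ,
    λ { (τ , (τ'∈ , τ''∈) , τ≺σ) → no-undercut σ'-min σ''-min τ'∈ τ''∈ τ≺σ }

  big-⊠ : ∀ (S' : Pred Π') (S'' : Pred Π'') (D : Pred Π) → D ⊆ (S' ⊠ S'') →
    (Big _⪯_ D (S' ⊠ S'') ⇔
      (∃ λ (G' : Pred Π') → ∃ λ (G'' : Pred Π'') →
         ((G' ⊠ G'') ⊆ D) × Big _⪯'_ G' S' × Big _⪯''_ G'' S''))
  big-⊠ S' S'' D D⊆ = mk⇔
    (λ { (_ , μ⊆D) → μ' S' , μ'' S'' , (λ σ m → μ⊆D σ (μ-⊠-⊇ S' S'' σ m)) ,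
                      ChoiceFunction.μ-big _⪯'_ S' , ChoiceFunction.μ-big _⪯''_ S'' })
    (λ { (G' , G'' , G⊆D , (_ , μ'⊆G') , (_ , μ''⊆G'')) →
           D⊆ , λ σ m → let (m' , m'') = μ-⊠-⊆ S' S'' σ m
                        in G⊆D σ (μ'⊆G' _ m' , μ''⊆G'' _ m'') })

  module Projections (smooth : IsSmooth) (S : Pred Π)
                     (μ-⊠-⊆S : (μ' (restr' S) ⊠ μ'' (restr'' S)) ⊆ S) where
    open ChoiceFunction

    S' : Pred Π'
    S' = restr' S
    S'' : Pred Π''
    S'' = restr'' S

    smooth' : Smooth _⪯'_
    smooth' = proj₁ (proj₂ smooth)
    smooth'' : Smooth _⪯''_
    smooth'' = proj₂ (proj₂ smooth)

    μ-res' : ∀ σ → μΠ S σ → μ' S' (res' σ)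
    μ-res' σ (sσ , σ-min) = restr'-∈ sσ , λ { (y' , y'∈ , y'≺) →
      let (z' , z'-min , z'≺) = minimal-below _⪯'_ smooth' (restr'-∈ sσ) y'∈ y'≺
      in minimal-dominates _⪯''_ smooth'' refl'' (restr''-∈ sσ) λ { (z'' , z''-min , z''⪯) →
           σ-min (concat z' z'' , μ-⊠-⊆S _ (z'-min , z''-min) , lift-≺' σ z'≺ z''⪯) } }

    μ-res'' : ∀ σ → μΠ S σ → μ'' S'' (res'' σ)
    μ-res'' σ (sσ , σ-min) = restr''-∈ sσ , λ { (y'' , y''∈ , y''≺) →
      let (z'' , z''-min , z''≺) = minimal-below _⪯''_ smooth'' (restr''-∈ sσ) y''∈ y''≺
      in minimal-dominates _⪯'_ smooth' refl' (restr'-∈ sσ) λ { (z' , z'-min , z'⪯) →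
           σ-min (concat z' z'' , μ-⊠-⊆S _ (z'-min , z''-min) , lift-≺'' σ z'⪯ z''≺) } }

    μ-projections : μΠ S ≐ (μ' S' ⊠ μ'' S'')
    μ-projections =
      (λ σ m → μ-res' σ m , μ-res'' σ m) ,
      (λ σ (m' , m'') → μ-⊠-⊆S σ (m' , m'') ,
         λ { (τ , sτ , τ≺σ) → no-undercut m' m'' (restr'-∈ sτ) (restr''-∈ sτ) τ≺σ })

fact4p9 : (I' I'' : Set) (Xs : I' ⊎ I'' → Set) (H : Split.Hamming I' I'' Xs) →
    let open Split I' I'' Xs
        open Hamming H
    in
    (IsSmooth →
      ∀ (S : Pred Π) →
        ((μ' (restr' S) ⊠ μ'' (restr'' S)) ⊆ S) →
        μΠ S ≐ (μ' (restr' S) ⊠ μ'' (restr'' S)))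
    ×
    (∀ (S' : Pred Π') (S'' : Pred Π'') →
        μΠ (S' ⊠ S'') ≐ (μ' S' ⊠ μ'' S''))
    ×
    (∀ (S' : Pred Π') (S'' : Pred Π'') (D : Pred Π) → D ⊆ (S' ⊠ S'') →
        (Big _⪯_ D (S' ⊠ S'') ⇔
          (∃ λ (G' : Pred Π') → ∃ λ (G'' : Pred Π'') →
             ((G' ⊠ G'') ⊆ D) × Big _⪯'_ G' S' × Big _⪯''_ G'' S'')))
fact4p9 I' I'' Xs H =
  (λ smooth S hyp → Projections.μ-projections smooth S hyp) ,
  (λ S' S'' → μ-⊠-⊆ S' S'' , μ-⊠-⊇ S' S'') ,
  big-⊠
  where open HammingFacts I' I'' Xs H
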